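{- Let $\mathcal{NCP}$ be the gap-insertion operad of the context and, for $n\ge2$, let $p_n=\{[n-1]\}\in\mathcal{NCP}(n)$ (the one-block partition of $[n-1]$). Then for all $m,n\ge2$, $p_m\diamond_m p_n=p_n\diamond_1 p_m$, and the non-symmetric set operad generated by elements $q_n$ of arity $n$ ($n\ge2$) subject to the relations $q_m\circ_m q_n=q_n\circ_1 q_m$ ($m,n\ge 2$) is isomorphic to $\mathcal{NCP}$ via the operad morphism sending $q_n$ to $p_n$. That is, $\mathcal{NCP}$ is generated by the $p_n$, $n\ge2$, with exactly these relations.
   Context: A noncrossing partition of $[n]=\{1,\dots,n\}$ is a partition into nonempty blocks with no $a,b$ in one block and $c,d$ in another with $a<c<b<d$; $\mathrm{NCP}(n)$ denotes their set, and $\mathrm{NCP}(0)=\{\emptyset\}$. For a set $X$ of integers, $X+j=\{x+j:x\in X\}$. The non-symmetric set operad $\mathcal{NCP}$ has $\mathcal{NCP}(n)=\mathrm{NCP}(n-1)$ for $n\ge1$ (so a partition of degree $n-1$ is an $n$-ary operation, its inputs being the $n$ gaps before, between and after its elements), $\mathcal{NCP}(0)=\emptyset$, unit the empty partition in $\mathcal{NCP}(1)$, and partial compositions: for $P\in\mathcal{NCP}(m)$, $Q\in\mathcal{NCP}(n)$ and $1\le i\le m$, $$P\diamond_iQ=\{\chi(\pi):\pi\in P\}\cup\{\rho+i-1:\rho\in Q\},$$ where $\chi(p)=p$ if $p<i$ and $\chi(p)=p+n-1$ otherwise (i.e. $Q$ is inserted into the $i$-th gap of $P$). -}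

module Defs where

open import Data.Nat using (ℕ; zero; suc; _+_; _∸_; _≤_; _<_; _<ᵇ_)
open import Data.Fin using (Fin; toℕ; fromℕ) renaming (zero to fzero)
open import Data.Bool using (Bool; true; false; if_then_else_)
open import Data.Product using (_×_)
open import Relation.Binary.PropositionalEquality using (_≡_)

-- A partition of [k] = {1,…,k} is encoded by its "same block" relation
-- R : ℕ → ℕ → Bool (R x y = true iff x and y lie in the same block);
-- only the values on [k] × [k] are meaningful.

BRel : Set
BRel = ℕ → ℕ → Bool

In : ℕ → ℕ → Set
In k x = (1 ≤ x) × (x ≤ k)

_≐⟨_⟩_ : BRel → ℕ → BRel → Set
R ≐⟨ k ⟩ S = ∀ x y → In k x → In k y → R x y ≡ S x y

record IsNCP (k : ℕ) (R : BRel) : Set where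
  field
    reflexive   : ∀ x → In k x → R x x ≡ true
    symmetric   : ∀ x y → In k x → In k y → R x y ≡ true → R y x ≡ true
    transitive  : ∀ x y z → In k x → In k y → In k z →
                  R x y ≡ true → R y z ≡ true → R x z ≡ true
    -- no a,b in one block and c,d in a different block with a<c<b<d
    noncrossing : ∀ a b c d → In k a → In k b → In k c → In k d →
                  a < c → c < b → b < d →
                  R a b ≡ true → R c d ≡ true → R a c ≡ true

-- Where an element x of [m+n-2] of P ◇_i Q comes from:
-- either χ(p) for p ∈ [m-1], or ρ+i-1 with ρ ∈ [n-1].
data Src : Set where
  fromP : ℕ → Src
  fromQ : ℕ → Src

src : (n i x : ℕ) → Src
src n i x =
  if x <ᵇ i then fromP x
  else if x <ᵇ i + n ∸ 1 then fromQ (x ∸ (i ∸ 1))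
  else fromP (x ∸ (n ∸ 1))

-- Partial composition P ◇_i Q of the operad NCP, on block relations,
-- where Q ∈ NCP(n) (a partition of [n-1]) and i is the (1-based) gap.
compR : (n i : ℕ) → BRel → BRel → BRel
compR n i P Q x y with src n i x | src n i y
... | fromP a | fromP b = P a b
... | fromQ a | fromQ b = Q a b
... | fromP _ | fromQ _ = false
... | fromQ _ | fromP _ = false

-- p_n = {[n-1]} : the one-block partition (all elements related)
pR : BRel
pR _ _ = true

-- the unit: the empty partition of [0]
unitR : BRel
unitR _ _ = false

-- Free non-symmetric operad on generators q_n (n ≥ 2).
-- Terms indexed by arity; gaps/inputs are 0-based Fin indices here:
-- f ∘⟨ i ⟩ g  is the paper's  f ∘_{toℕ i + 1} g.

data Tm : ℕ → Set where
  idₜ   : Tm 1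
  q     : (k : ℕ) → Tm (2 + k)
  _∘⟨_⟩_ : ∀ {m n} → Tm m → Fin m → Tm n → Tm (m + n ∸ 1)

infix 4 _~_
data _~_ : ∀ {a b} → Tm a → Tm b → Set where
  ~refl  : ∀ {a} {t : Tm a} → t ~ t
  ~sym   : ∀ {a b} {s : Tm a} {t : Tm b} → s ~ t → t ~ s
  ~trans : ∀ {a b c} {s : Tm a} {t : Tm b} {u : Tm c} → s ~ t → t ~ u → s ~ u
  ~cong  : ∀ {m m' n n'} {f : Tm m} {f' : Tm m'} {g : Tm n} {g' : Tm n'}
           (i : Fin m) (i' : Fin m') → toℕ i ≡ toℕ i' →
           f ~ f' → g ~ g' → (f ∘⟨ i ⟩ g) ~ (f' ∘⟨ i' ⟩ g')
  unitˡ  : ∀ {n} (f : Tm n) → (idₜ ∘⟨ fzero ⟩ f) ~ f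
  unitʳ  : ∀ {m} (f : Tm m) (i : Fin m) → (f ∘⟨ i ⟩ idₜ) ~ f
  assocSeq : ∀ {m n p} (f : Tm m) (g : Tm n) (h : Tm p)
             (i : Fin m) (j : Fin n) (k : Fin (m + n ∸ 1)) →
             toℕ k ≡ toℕ i + toℕ j →
             ((f ∘⟨ i ⟩ g) ∘⟨ k ⟩ h) ~ (f ∘⟨ i ⟩ (g ∘⟨ j ⟩ h))
  assocPar : ∀ {m n p} (f : Tm m) (g : Tm n) (h : Tm p)
             (i k : Fin m) (k' : Fin (m + n ∸ 1)) (i' : Fin (m + p ∸ 1)) →
             toℕ i < toℕ k → toℕ k' ≡ toℕ k + n ∸ 1 → toℕ i' ≡ toℕ i →
             ((f ∘⟨ i ⟩ g) ∘⟨ k' ⟩ h) ~ ((f ∘⟨ k ⟩ h) ∘⟨ i' ⟩ g)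
  qrel   : ∀ a b → (q a ∘⟨ fromℕ (suc a) ⟩ q b) ~ (q b ∘⟨ fzero ⟩ q a)

eval : ∀ {a} → Tm a → BRel
eval idₜ = unitR
eval (q k) = pR
eval (_∘⟨_⟩_ {m} {n} f i g) = compR n (suc (toℕ i)) (eval f) (eval g)

-- Inserting Q into a gap of P places the blocks of Q on an interval of positions.
-- Conversely, in a noncrossing partition the block of the largest block minimum is
-- an interval [b, b + k]; removing it leaves a noncrossing partition into which that
-- block is re-inserted as p_{k+2}, so by induction every partition is the value of a
-- term (surjectivity).  Using the operad axioms and q_m ∘_m q_n = q_n ∘_1 q_m, every
-- term rewrites to an increasing comb (…(id ∘_{i₁} q_{k₁}) ∘_{i₂} …) ∘_{iₙ} q_{kₙ}
-- with i₁ < … < iₙ.  The value of such a comb determines its last gap (where its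
-- largest block minimum sits) and its last generator (the size of that block), and
-- removing that block gives the value of the shorter comb; hence two terms with equal
-- values have equal normal forms, and the evaluation is faithful.

module Submission where

open import Defs
open import Data.Bool using (Bool; true; false; T)
import Data.Bool as Bool
open import Data.Bool.Properties using (¬-not)
open import Data.Empty using (⊥; ⊥-elim)
open import Data.Fin using (Fin; toℕ; fromℕ; fromℕ<)
import Data.Fin as Fin
open import Data.Fin.Properties using (toℕ<n; toℕ-fromℕ; toℕ-fromℕ<; toℕ-cast)
open import Data.Nat
open import Data.Nat.Induction using (<-rec)
open import Data.Nat.Properties
open import Data.Nat.Tactic.RingSolver using (solve-∀)
open import Data.Product using (_×_; Σ; _,_; proj₁; proj₂)
open import Data.Sum using (_⊎_; inj₁; inj₂)
open import Data.Unit using (⊤; tt)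
open import Relation.Binary.Definitions using (tri<; tri≈; tri>)
open import Relation.Binary.PropositionalEquality
open import Relation.Nullary using (¬_; yes; no)
open import Relation.Nullary.Decidable using (_×-dec_)
open import Relation.Unary using (Decidable)

≐-sym : ∀ {k R S} → R ≐⟨ k ⟩ S → S ≐⟨ k ⟩ R
≐-sym R≐S x y x∈ y∈ = sym (R≐S x y x∈ y∈)

≐-trans : ∀ {k R S U} → R ≐⟨ k ⟩ S → S ≐⟨ k ⟩ U → R ≐⟨ k ⟩ U
≐-trans R≐S S≐U x y x∈ y∈ = trans (R≐S x y x∈ y∈) (S≐U x y x∈ y∈)

≐-cast : ∀ {k k′ R S} → k ≡ k′ → R ≐⟨ k ⟩ S → R ≐⟨ k′ ⟩ S
≐-cast refl R≐S = R≐S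

+-suc-∸1 : ∀ m n → m + suc n ∸ 1 ≡ m + n
+-suc-∸1 m n = cong (_∸ 1) (+-suc m n)

false≢true : false ≢ true
false≢true ()

<ᵇ-true : ∀ {x y} → (x <ᵇ y) ≡ true → x < y
<ᵇ-true {x} {y} e = <ᵇ⇒< x y (subst T (sym e) tt)

<ᵇ-false : ∀ {x y} → (x <ᵇ y) ≡ false → y ≤ x
<ᵇ-false e = ≮⇒≥ (λ x<y → subst T e (<⇒<ᵇ x<y))

data SrcView (n i x : ℕ) : Src → Set where
  before : x ≤ i → SrcView n i x (fromP x)
  inside : ∀ r → In n r → x ≡ i + r → SrcView n i x (fromQ r)
  after  : ∀ z → i < z → x ≡ z + n → SrcView n i x (fromP z)

srcView : ∀ n i x → SrcView n i x (src (suc n) (suc i) x)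
srcView n i x with x <ᵇ suc i in x≤i
... | true = before (s≤s⁻¹ (<ᵇ-true x≤i))
... | false with x <ᵇ i + suc n in x≤i+n
...   | true = inside (x ∸ i) (m<n⇒0<n∸m i<x , m≤n+o⇒m∸n≤o x i x≤i+n′)
                 (sym (m+[n∸m]≡n (<⇒≤ i<x)))
  where
  i<x : i < x
  i<x = <ᵇ-false x≤i
  x≤i+n′ : x ≤ i + n
  x≤i+n′ = s≤s⁻¹ (subst (x <_) (+-suc i n) (<ᵇ-true x≤i+n))
...   | false = after (x ∸ n) (m+n≤o⇒m≤o∸n (suc i) i+n<x) (sym (m∸n+n≡m (m+n≤o⇒n≤o (suc i) i+n<x)))
  where
  i+n<x : suc i + n ≤ x
  i+n<x = subst (_≤ x) (+-suc i n) (<ᵇ-false x≤i+n)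

before≢inside : ∀ {n i x r} → x ≤ i → In n r → x ≡ i + r → ⊥
before≢inside {i = i} x≤i (s≤s z≤n , _) refl = m+1+n≰m i x≤i
before≢after : ∀ {n i x z} → x ≤ i → i < z → x ≡ z + n → ⊥
before≢after {n} {z = z} x≤i i<z refl = <⇒≱ i<z (≤-trans (m≤m+n z n) x≤i)
inside≢after : ∀ {n i x r z} → In n r → x ≡ i + r → i < z → x ≡ z + n → ⊥
inside≢after {n} {i} (_ , r≤n) refl i<z e = <⇒≱ (+-monoˡ-< n i<z) (subst (_≤ i + n) e (+-monoʳ-≤ i r≤n))

view-unique : ∀ {n i x s t} → SrcView n i x s → SrcView n i x t → s ≡ t
view-unique (before _)        (before _)        = refl
view-unique (inside _ _ refl) (inside _ _ e)    = cong fromQ (+-cancelˡ-≡ _ _ _ e)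
view-unique (after _ _ refl)  (after _ _ e)     = cong fromP (+-cancelʳ-≡ _ _ _ e)
view-unique (before x≤i)      (inside _ r∈ e)   = ⊥-elim (before≢inside x≤i r∈ e)
view-unique (inside _ r∈ e)   (before x≤i)      = ⊥-elim (before≢inside x≤i r∈ e)
view-unique (before x≤i)      (after _ i<z e)   = ⊥-elim (before≢after x≤i i<z e)
view-unique (after _ i<z e)   (before x≤i)      = ⊥-elim (before≢after x≤i i<z e)
view-unique (inside _ r∈ e)   (after _ i<z e′)  = ⊥-elim (inside≢after r∈ e i<z e′)
view-unique (after _ i<z e′)  (inside _ r∈ e)   = ⊥-elim (inside≢after r∈ e i<z e′)

src-view : ∀ {n i x s} → SrcView n i x s → src (suc n) (suc i) x ≡ s
src-view {n} {i} {x} = view-unique (srcView n i x)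

srcRel : BRel → BRel → Src → Src → Bool
srcRel P Q (fromP a) (fromP b) = P a b
srcRel P Q (fromQ a) (fromQ b) = Q a b
srcRel P Q (fromP _) (fromQ _) = false
srcRel P Q (fromQ _) (fromP _) = false

compR-src : ∀ n i P Q x y → compR n i P Q x y ≡ srcRel P Q (src n i x) (src n i y)
compR-src n i P Q x y with src n i x | src n i y
... | fromP _ | fromP _ = refl
... | fromP _ | fromQ _ = refl
... | fromQ _ | fromP _ = refl
... | fromQ _ | fromQ _ = refl

compR-view : ∀ {n i x y s t} P Q → SrcView n i x s → SrcView n i y t →
             compR (suc n) (suc i) P Q x y ≡ srcRel P Q s t
compR-view {n} {i} {x} {y} P Q vx vy =
  trans (compR-src (suc n) (suc i) P Q x y) (cong₂ (srcRel P Q) (src-view vx) (src-view vy))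

SrcIn : ℕ → ℕ → Src → Set
SrcIn m n (fromP a) = In m a
SrcIn m n (fromQ b) = In n b

view-in : ∀ {m n i x s} → i ≤ m → In (m + n) x → SrcView n i x s → SrcIn m n s
view-in i≤m (1≤x , _)   (before x≤i)        = 1≤x , ≤-trans x≤i i≤m
view-in _   _           (inside _ r∈ _)     = r∈
view-in {m} {n} _ (_ , x≤m+n) (after z i<z refl) = ≤-trans (s≤s z≤n) i<z , +-cancelʳ-≤ n z m x≤m+n

-- The paper's χ: the position of the element z of P in P ⋄_{i+1} Q when Q is a partition of [n].
χ : (n i z : ℕ) → ℕ
χ n i z with z ≤? i
... | yes _ = z
... | no  _ = z + n

χ-view : ∀ n i z → SrcView n i (χ n i z) (fromP z)
χ-view n i z with z ≤? i
... | yes z≤i = before z≤i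
... | no  z≰i = after z (≰⇒> z≰i) refl

viewᴾ⇒χ : ∀ {n i x z} → SrcView n i x (fromP z) → x ≡ χ n i z
viewᴾ⇒χ {i = i} {z = z} (before z≤i) with z ≤? i
... | yes _   = refl
... | no  z≰i = ⊥-elim (z≰i z≤i)
viewᴾ⇒χ {i = i} (after z i<z refl) with z ≤? i
... | yes z≤i = ⊥-elim (<⇒≱ i<z z≤i)
... | no  _   = refl

χ-in : ∀ {m n i z} → i ≤ m → In m z → In (m + n) (χ n i z)
χ-in {m} {n} {i} {z} i≤m (1≤z , z≤m) with z ≤? i
... | yes _ = 1≤z , ≤-trans z≤m (m≤m+n m n)
... | no  _ = ≤-trans 1≤z (m≤m+n z n) , +-monoˡ-≤ n z≤m

χ-≥ : ∀ n i z → z ≤ χ n i z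
χ-≥ n i z with z ≤? i
... | yes _ = ≤-refl
... | no  _ = m≤m+n z n

compR-χ : ∀ n i P Q x y → compR (suc n) (suc i) P Q (χ n i x) (χ n i y) ≡ P x y
compR-χ n i P Q x y = compR-view P Q (χ-view n i x) (χ-view n i y)

compR-cancelˡ : ∀ {m n i P P′ Q Q′} → i ≤ m →
                compR (suc n) (suc i) P Q ≐⟨ m + n ⟩ compR (suc n) (suc i) P′ Q′ → P ≐⟨ m ⟩ P′
compR-cancelˡ {m} {n} {i} {P} {P′} {Q} {Q′} i≤m PQ≐P′Q′ x y x∈ y∈ =
  trans (sym (compR-χ n i P Q x y))
    (trans (PQ≐P′Q′ (χ n i x) (χ n i y) (χ-in i≤m x∈) (χ-in i≤m y∈)) (compR-χ n i P′ Q′ x y))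

viewᴾ-<-cancel : ∀ {n i x y a b} → SrcView n i x (fromP a) → SrcView n i y (fromP b) → x < y → a < b
viewᴾ-<-cancel (before _) (before _) x<y = x<y
viewᴾ-<-cancel (before a≤i) (after _ i<b _) _ = ≤-<-trans a≤i i<b
viewᴾ-<-cancel {n} (after a i<a refl) (before y≤i) x<y =
  ⊥-elim (<⇒≱ x<y (≤-trans y≤i (≤-trans (<⇒≤ i<a) (m≤m+n a n))))
viewᴾ-<-cancel {n} (after a _ refl) (after b _ refl) x<y = +-cancelʳ-< n a b x<y

viewᴾ-<-mono : ∀ {n i x y a b} → SrcView n i x (fromP a) → SrcView n i y (fromP b) → a < b → x < y
viewᴾ-<-mono (before _) (before _) a<b = a<b
viewᴾ-<-mono {n} (before _) (after b _ refl) a<b = <-≤-trans a<b (m≤m+n b n)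
viewᴾ-<-mono (after a i<a _) (before b≤i) a<b = ⊥-elim (<-asym i<a (<-≤-trans a<b b≤i))
viewᴾ-<-mono {n} (after _ _ refl) (after _ _ refl) a<b = +-monoˡ-< n a<b

viewᑫ-<-cancel : ∀ {n i x y a b} → SrcView n i x (fromQ a) → SrcView n i y (fromQ b) → x < y → a < b
viewᑫ-<-cancel {i = i} (inside a _ refl) (inside b _ refl) x<y = +-cancelˡ-< i a b x<y

viewᴾ-between-viewᑫ-⊥ : ∀ {n i x y z a b c} → SrcView n i x (fromQ a) → SrcView n i y (fromP b) →
                        SrcView n i z (fromQ c) → x < y → y < z → ⊥
viewᴾ-between-viewᑫ-⊥ {i = i} (inside a _ refl) (before y≤i) _ x<y _ =
  <⇒≱ x<y (≤-trans y≤i (m≤m+n i a))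
viewᴾ-between-viewᑫ-⊥ {n} {i} _ (after b i<b refl) (inside c (_ , c≤n) refl) _ y<z =
  <⇒≱ y<z (≤-trans (+-monoʳ-≤ i c≤n) (+-monoˡ-≤ n (<⇒≤ i<b)))

flipSrc : Src → Src
flipSrc (fromP a) = fromQ a
flipSrc (fromQ a) = fromP a

srcRel-p-flip : ∀ s t → srcRel pR pR (flipSrc s) (flipSrc t) ≡ srcRel pR pR s t
srcRel-p-flip (fromP _) (fromP _) = refl
srcRel-p-flip (fromP _) (fromQ _) = refl
srcRel-p-flip (fromQ _) (fromP _) = refl
srcRel-p-flip (fromQ _) (fromQ _) = refl

-- Inserting at the last gap of an (m′+1)-ary operation and at the first gap of an
-- (n′+1)-ary one split [m′ + n′] into the same two intervals, with the roles swapped.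
src-last≡flip-src-first : ∀ m′ n′ x → In (m′ + n′) x →
                          src (suc n′) (suc m′) x ≡ flipSrc (src (suc m′) 1 x)
src-last≡flip-src-first m′ n′ x (1≤x , x≤m′+n′) with x ≤? m′
... | yes x≤m′ = trans (src-view (before x≤m′)) (cong flipSrc (sym (src-view {i = 0} (inside x (1≤x , x≤m′) refl))))
... | no  x≰m′ = trans (src-view (inside r (r>0 , r≤n′) x≡m′+r))
                       (cong flipSrc (sym (src-view {i = 0} (after r r>0 (trans x≡m′+r (+-comm m′ r))))))
  where
  r = x ∸ m′
  r>0 : 0 < r
  r>0 = m<n⇒0<n∸m (≰⇒> x≰m′)
  r≤n′ : r ≤ n′
  r≤n′ = m≤n+o⇒m∸n≤o x m′ x≤m′+n′
  x≡m′+r : x ≡ m′ + r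
  x≡m′+r = sym (m+[n∸m]≡n (<⇒≤ (≰⇒> x≰m′)))

p-last≐p-first : ∀ m′ n′ → compR (suc n′) (suc m′) pR pR ≐⟨ m′ + n′ ⟩ compR (suc m′) 1 pR pR
p-last≐p-first m′ n′ x y x∈ y∈ = begin
  compR (suc n′) (suc m′) pR pR x y
    ≡⟨ compR-src (suc n′) (suc m′) pR pR x y ⟩
  srcRel pR pR (src (suc n′) (suc m′) x) (src (suc n′) (suc m′) y)
    ≡⟨ cong₂ (srcRel pR pR) (src-last≡flip-src-first m′ n′ x x∈) (src-last≡flip-src-first m′ n′ y y∈) ⟩
  srcRel pR pR (flipSrc (src (suc m′) 1 x)) (flipSrc (src (suc m′) 1 y))
    ≡⟨ srcRel-p-flip (src (suc m′) 1 x) (src (suc m′) 1 y) ⟩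
  srcRel pR pR (src (suc m′) 1 x) (src (suc m′) 1 y)
    ≡⟨ compR-src (suc m′) 1 pR pR x y ⟨
  compR (suc m′) 1 pR pR x y ∎
  where open ≡-Reasoning

data CompEdge (m n i : ℕ) (P Q : BRel) (x y : ℕ) : Set where
  viaP : ∀ {a b} → SrcView n i x (fromP a) → SrcView n i y (fromP b) →
         In m a → In m b → P a b ≡ true → CompEdge m n i P Q x y
  viaQ : ∀ {a b} → SrcView n i x (fromQ a) → SrcView n i y (fromQ b) →
         In n a → In n b → Q a b ≡ true → CompEdge m n i P Q x y

compR-edge : ∀ {m n i P Q x y} → i ≤ m → In (m + n) x → In (m + n) y →
             compR (suc n) (suc i) P Q x y ≡ true → CompEdge m n i P Q x y
compR-edge {m} {n} {i} {P} {Q} {x} {y} i≤m x∈ y∈ xy =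
  edge (srcView n i x) (srcView n i y) (trans (sym (compR-view P Q (srcView n i x) (srcView n i y))) xy)
  where
  edge : ∀ {s t} → SrcView n i x s → SrcView n i y t → srcRel P Q s t ≡ true → CompEdge m n i P Q x y
  edge {fromP _} {fromP _} vx vy ab = viaP vx vy (view-in i≤m x∈ vx) (view-in i≤m y∈ vy) ab
  edge {fromQ _} {fromQ _} vx vy ab = viaQ vx vy (view-in i≤m x∈ vx) (view-in i≤m y∈ vy) ab
  edge {fromP _} {fromQ _} _ _ ()
  edge {fromQ _} {fromP _} _ _ ()

compR-isNCP : ∀ {m n i P Q} → i ≤ m → IsNCP m P → IsNCP n Q → IsNCP (m + n) (compR (suc n) (suc i) P Q)
compR-isNCP {m} {n} {i} {P} {Q} i≤m ncpP ncpQ = record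
  { reflexive   = refl′
  ; symmetric   = sym′
  ; transitive  = trans′
  ; noncrossing = noncrossing′
  }
  where
  module P = IsNCP ncpP
  module Q = IsNCP ncpQ
  R = compR (suc n) (suc i) P Q
  edge : ∀ {x y} → In (m + n) x → In (m + n) y → R x y ≡ true → CompEdge m n i P Q x y
  edge = compR-edge i≤m

  refl′ : ∀ x → In (m + n) x → R x x ≡ true
  refl′ x x∈ = go (srcView n i x)
    where
    go : ∀ {s} → SrcView n i x s → R x x ≡ true
    go {fromP a} v = trans (compR-view P Q v v) (P.reflexive a (view-in i≤m x∈ v))
    go {fromQ a} v = trans (compR-view P Q v v) (Q.reflexive a (view-in i≤m x∈ v))

  sym′ : ∀ x y → In (m + n) x → In (m + n) y → R x y ≡ true → R y x ≡ true
  sym′ x y x∈ y∈ xy with edge x∈ y∈ xy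
  ... | viaP vx vy a∈ b∈ ab = trans (compR-view P Q vy vx) (P.symmetric _ _ a∈ b∈ ab)
  ... | viaQ vx vy a∈ b∈ ab = trans (compR-view P Q vy vx) (Q.symmetric _ _ a∈ b∈ ab)

  trans′ : ∀ x y z → In (m + n) x → In (m + n) y → In (m + n) z →
           R x y ≡ true → R y z ≡ true → R x z ≡ true
  trans′ x y z x∈ y∈ z∈ xy yz with edge x∈ y∈ xy | edge y∈ z∈ yz
  ... | viaP vx vy a∈ b∈ ab | viaP vy′ vz b∈′ c∈ bc with view-unique vy vy′
  ...   | refl = trans (compR-view P Q vx vz) (P.transitive _ _ _ a∈ b∈ c∈ ab bc)
  trans′ x y z x∈ y∈ z∈ xy yz | viaQ vx vy a∈ b∈ ab | viaQ vy′ vz b∈′ c∈ bc with view-unique vy vy′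
  ...   | refl = trans (compR-view P Q vx vz) (Q.transitive _ _ _ a∈ b∈ c∈ ab bc)
  trans′ x y z x∈ y∈ z∈ xy yz | viaP _ vy _ _ _ | viaQ vy′ _ _ _ _ with view-unique vy vy′
  ...   | ()
  trans′ x y z x∈ y∈ z∈ xy yz | viaQ _ vy _ _ _ | viaP vy′ _ _ _ _ with view-unique vy vy′
  ...   | ()

  noncrossing′ : ∀ a b c d → In (m + n) a → In (m + n) b → In (m + n) c → In (m + n) d →
                 a < c → c < b → b < d → R a b ≡ true → R c d ≡ true → R a c ≡ true
  noncrossing′ a b c d a∈ b∈ c∈ d∈ a<c c<b b<d ab cd with edge a∈ b∈ ab | edge c∈ d∈ cd
  ... | viaP va vb a∈′ b∈′ ab′ | viaP vc vd c∈′ d∈′ cd′ =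
    trans (compR-view P Q va vc)
      (P.noncrossing _ _ _ _ a∈′ b∈′ c∈′ d∈′
        (viewᴾ-<-cancel va vc a<c) (viewᴾ-<-cancel vc vb c<b) (viewᴾ-<-cancel vb vd b<d) ab′ cd′)
  ... | viaQ va vb a∈′ b∈′ ab′ | viaQ vc vd c∈′ d∈′ cd′ =
    trans (compR-view P Q va vc)
      (Q.noncrossing _ _ _ _ a∈′ b∈′ c∈′ d∈′
        (viewᑫ-<-cancel va vc a<c) (viewᑫ-<-cancel vc vb c<b) (viewᑫ-<-cancel vb vd b<d) ab′ cd′)
  ... | viaP _ vb _ _ _ | viaQ vc vd _ _ _ = ⊥-elim (viewᴾ-between-viewᑫ-⊥ vc vb vd c<b b<d)
  ... | viaQ va vb _ _ _ | viaP vc _ _ _ _ = ⊥-elim (viewᴾ-between-viewᑫ-⊥ va vc vb a<c c<b)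

isNCP-0 : ∀ R → IsNCP 0 R
isNCP-0 R = record
  { reflexive   = λ _ x∈ → ⊥-elim (∉[0] x∈)
  ; symmetric   = λ _ _ x∈ _ _ → ⊥-elim (∉[0] x∈)
  ; transitive  = λ _ _ _ x∈ _ _ _ _ → ⊥-elim (∉[0] x∈)
  ; noncrossing = λ _ _ _ _ x∈ _ _ _ _ _ _ _ _ → ⊥-elim (∉[0] x∈)
  }
  where
  ∉[0] : ∀ {x} → ¬ In 0 x
  ∉[0] (1≤x , x≤0) = <⇒≱ 1≤x x≤0

pR-isNCP : ∀ k → IsNCP k pR
pR-isNCP k = record
  { reflexive   = λ _ _ → refl
  ; symmetric   = λ _ _ _ _ _ → refl
  ; transitive  = λ _ _ _ _ _ _ _ _ → refl
  ; noncrossing = λ _ _ _ _ _ _ _ _ _ _ _ _ _ → refl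
  }

arity-suc : ∀ {a} → Tm a → Σ ℕ λ a′ → a ≡ suc a′
arity-suc idₜ = 0 , refl
arity-suc (q k) = suc k , refl
arity-suc (f ∘⟨ i ⟩ g) with arity-suc f | arity-suc g
... | m′ , refl | n′ , refl = m′ + n′ , +-suc m′ n′

eval-isNCP : ∀ {a} (t : Tm a) → IsNCP (a ∸ 1) (eval t)
eval-isNCP idₜ = isNCP-0 unitR
eval-isNCP (q k) = pR-isNCP (suc k)
eval-isNCP (f ∘⟨ i ⟩ g) with arity-suc f | arity-suc g
... | m′ , refl | n′ , refl = subst (λ k → IsNCP k (eval (f ∘⟨ i ⟩ g))) (sym (+-suc-∸1 m′ n′))
                                (compR-isNCP (s≤s⁻¹ (toℕ<n i)) (eval-isNCP f) (eval-isNCP g))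

~-arity : ∀ {a b} {s : Tm a} {t : Tm b} → s ~ t → a ≡ b
~-arity ~refl = refl
~-arity (~sym s~t) = sym (~-arity s~t)
~-arity (~trans s~t t~u) = trans (~-arity s~t) (~-arity t~u)
~-arity (~cong _ _ _ f~f′ g~g′) = cong₂ (λ m n → m + n ∸ 1) (~-arity f~f′) (~-arity g~g′)
~-arity (unitˡ f) = refl
~-arity (unitʳ {m} f i) = m+n∸n≡m m 1
~-arity (assocSeq f g h _ _ _ _) with arity-suc f | arity-suc g | arity-suc h
... | m′ , refl | n′ , refl | p′ , refl = trans (+-suc-∸1 (m′ + suc n′) p′) (arith m′ n′ p′)
  where
  arith : ∀ m n p → m + suc n + p ≡ m + (n + suc p)
  arith = solve-∀
~-arity (assocPar f g h _ _ _ _ _ _ _) with arity-suc f | arity-suc g | arity-suc h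
... | m′ , refl | n′ , refl | p′ , refl = cong (_∸ 1) (arith m′ n′ p′)
  where
  arith : ∀ m n p → m + suc n + suc p ≡ m + suc p + suc n
  arith = solve-∀
~-arity (qrel a b) = arith a b
  where
  arith : ∀ a b → suc a + suc (suc b) ≡ suc b + suc (suc a)
  arith = solve-∀

srcRel-cong : ∀ {m n F F′ G G′} → F ≐⟨ m ⟩ F′ → G ≐⟨ n ⟩ G′ →
              ∀ s t → SrcIn m n s → SrcIn m n t → srcRel F G s t ≡ srcRel F′ G′ s t
srcRel-cong F≐F′ _ (fromP a) (fromP b) a∈ b∈ = F≐F′ a b a∈ b∈
srcRel-cong _ G≐G′ (fromQ a) (fromQ b) a∈ b∈ = G≐G′ a b a∈ b∈
srcRel-cong _ _ (fromP _) (fromQ _) _ _ = refl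
srcRel-cong _ _ (fromQ _) (fromP _) _ _ = refl

compR-cong : ∀ {m n i F F′ G G′} → i ≤ m → F ≐⟨ m ⟩ F′ → G ≐⟨ n ⟩ G′ →
             compR (suc n) (suc i) F G ≐⟨ m + n ⟩ compR (suc n) (suc i) F′ G′
compR-cong {m} {n} {i} {F} {F′} {G} {G′} i≤m F≐F′ G≐G′ x y x∈ y∈ = begin
  compR (suc n) (suc i) F G x y   ≡⟨ compR-view F G vx vy ⟩
  srcRel F G sx sy                ≡⟨ srcRel-cong F≐F′ G≐G′ sx sy (view-in i≤m x∈ vx) (view-in i≤m y∈ vy) ⟩
  srcRel F′ G′ sx sy              ≡⟨ compR-view F′ G′ vx vy ⟨
  compR (suc n) (suc i) F′ G′ x y ∎
  where
  open ≡-Reasoning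
  sx = src (suc n) (suc i) x
  sy = src (suc n) (suc i) y
  vx = srcView n i x
  vy = srcView n i y

compR-unitˡ : ∀ n F → compR (suc n) 1 unitR F ≐⟨ n ⟩ F
compR-unitˡ n F x y x∈ y∈ = compR-view {i = 0} unitR F (inside x x∈ refl) (inside y y∈ refl)

src-unary : ∀ i x → src 1 (suc i) x ≡ fromP x
src-unary i x with src 1 (suc i) x | srcView 0 i x
... | _ | before _ = refl
... | _ | inside _ (1≤r , r≤0) _ = ⊥-elim (<⇒≱ 1≤r r≤0)
... | _ | after z _ refl = cong fromP (sym (+-identityʳ z))

compR-unitʳ : ∀ i F x y → compR 1 (suc i) F unitR x y ≡ F x y
compR-unitʳ i F x y = trans (compR-src 1 (suc i) F unitR x y) (cong₂ (srcRel F unitR) (src-unary i x) (src-unary i y))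

-- Both sides of an associativity law are compared by labelling every position with the
-- operand (F, G or H) it comes from; src₃-seq and src₃-par show the labellings agree.
data Src₃ : Set where
  fromF fromG fromH : ℕ → Src₃

srcRel₃ : BRel → BRel → BRel → Src₃ → Src₃ → Bool
srcRel₃ F G H (fromF a) (fromF b) = F a b
srcRel₃ F G H (fromG a) (fromG b) = G a b
srcRel₃ F G H (fromH a) (fromH b) = H a b
srcRel₃ F G H _         _         = false

fromFG : Src → Src₃
fromFG (fromP a) = fromF a
fromFG (fromQ b) = fromG b

fromGH : Src → Src₃
fromGH (fromP a) = fromG a
fromGH (fromQ b) = fromH b

src₃ˡ : (n i : ℕ) → Src → Src₃
src₃ˡ n i (fromP a) = fromFG (src n i a)
src₃ˡ n i (fromQ b) = fromH b

src₃ʳ : (n i : ℕ) → Src → Src₃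
src₃ʳ n i (fromP a) = fromF a
src₃ʳ n i (fromQ b) = fromGH (src n i b)

swapGH : Src₃ → Src₃
swapGH (fromF a) = fromF a
swapGH (fromG a) = fromH a
swapGH (fromH a) = fromG a

module _ (F G H : BRel) where

  srcRel₃-FG : ∀ s t → srcRel F G s t ≡ srcRel₃ F G H (fromFG s) (fromFG t)
  srcRel₃-FG (fromP _) (fromP _) = refl
  srcRel₃-FG (fromP _) (fromQ _) = refl
  srcRel₃-FG (fromQ _) (fromP _) = refl
  srcRel₃-FG (fromQ _) (fromQ _) = refl

  srcRel₃-GH : ∀ s t → srcRel G H s t ≡ srcRel₃ F G H (fromGH s) (fromGH t)
  srcRel₃-GH (fromP _) (fromP _) = refl
  srcRel₃-GH (fromP _) (fromQ _) = refl
  srcRel₃-GH (fromQ _) (fromP _) = refl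
  srcRel₃-GH (fromQ _) (fromQ _) = refl

  srcRel₃-swapGH : ∀ u v → srcRel₃ F H G u v ≡ srcRel₃ F G H (swapGH u) (swapGH v)
  srcRel₃-swapGH (fromF _) (fromF _) = refl
  srcRel₃-swapGH (fromF _) (fromG _) = refl
  srcRel₃-swapGH (fromF _) (fromH _) = refl
  srcRel₃-swapGH (fromG _) (fromF _) = refl
  srcRel₃-swapGH (fromG _) (fromG _) = refl
  srcRel₃-swapGH (fromG _) (fromH _) = refl
  srcRel₃-swapGH (fromH _) (fromF _) = refl
  srcRel₃-swapGH (fromH _) (fromG _) = refl
  srcRel₃-swapGH (fromH _) (fromH _) = refl

  compR-compRˡ : ∀ n₂ i₂ n₁ i₁ x y →
    compR n₂ i₂ (compR n₁ i₁ F G) H x y ≡ srcRel₃ F G H (src₃ˡ n₁ i₁ (src n₂ i₂ x)) (src₃ˡ n₁ i₁ (src n₂ i₂ y))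
  compR-compRˡ n₂ i₂ n₁ i₁ x y = trans (compR-src n₂ i₂ _ H x y) (outer (src n₂ i₂ x) (src n₂ i₂ y))
    where
    inner : ℕ → Src₃
    inner a = fromFG (src n₁ i₁ a)
    inner≢H : ∀ a b → srcRel₃ F G H (inner a) (fromH b) ≡ false
    inner≢H a b with src n₁ i₁ a
    ... | fromP _ = refl
    ... | fromQ _ = refl
    H≢inner : ∀ a b → srcRel₃ F G H (fromH a) (inner b) ≡ false
    H≢inner a b with src n₁ i₁ b
    ... | fromP _ = refl
    ... | fromQ _ = refl
    outer : ∀ s t → srcRel (compR n₁ i₁ F G) H s t ≡ srcRel₃ F G H (src₃ˡ n₁ i₁ s) (src₃ˡ n₁ i₁ t)
    outer (fromP a) (fromP b) = trans (compR-src n₁ i₁ F G a b) (srcRel₃-FG (src n₁ i₁ a) (src n₁ i₁ b))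
    outer (fromP a) (fromQ b) = sym (inner≢H a b)
    outer (fromQ a) (fromP b) = sym (H≢inner a b)
    outer (fromQ a) (fromQ b) = refl

  compR-compRʳ : ∀ n₂ i₂ n₁ i₁ x y →
    compR n₂ i₂ F (compR n₁ i₁ G H) x y ≡ srcRel₃ F G H (src₃ʳ n₁ i₁ (src n₂ i₂ x)) (src₃ʳ n₁ i₁ (src n₂ i₂ y))
  compR-compRʳ n₂ i₂ n₁ i₁ x y = trans (compR-src n₂ i₂ F _ x y) (outer (src n₂ i₂ x) (src n₂ i₂ y))
    where
    inner : ℕ → Src₃
    inner b = fromGH (src n₁ i₁ b)
    inner≢F : ∀ a b → srcRel₃ F G H (inner a) (fromF b) ≡ false
    inner≢F a b with src n₁ i₁ a
    ... | fromP _ = refl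
    ... | fromQ _ = refl
    F≢inner : ∀ a b → srcRel₃ F G H (fromF a) (inner b) ≡ false
    F≢inner a b with src n₁ i₁ b
    ... | fromP _ = refl
    ... | fromQ _ = refl
    outer : ∀ s t → srcRel F (compR n₁ i₁ G H) s t ≡ srcRel₃ F G H (src₃ʳ n₁ i₁ s) (src₃ʳ n₁ i₁ t)
    outer (fromQ a) (fromQ b) = trans (compR-src n₁ i₁ G H a b) (srcRel₃-GH (src n₁ i₁ a) (src n₁ i₁ b))
    outer (fromQ a) (fromP b) = sym (inner≢F a b)
    outer (fromP a) (fromQ b) = sym (F≢inner a b)
    outer (fromP a) (fromP b) = refl

src₃-seq : ∀ n′ p′ i j x → j ≤ n′ →
  src₃ˡ (suc n′) (suc i) (src (suc p′) (suc (i + j)) x) ≡ src₃ʳ (suc p′) (suc j) (src (suc (n′ + p′)) (suc i) x)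
src₃-seq n′ p′ i j x j≤n′ with src (suc p′) (suc (i + j)) x | srcView p′ (i + j) x
... | _ | before x≤i+j with src (suc n′) (suc i) x | srcView n′ i x
...   | _ | before x≤i
          rewrite src-view {n′ + p′} {i} (before x≤i) = refl
...   | _ | inside r (1≤r , r≤n′) refl
          rewrite src-view {n′ + p′} {i} (inside r (1≤r , ≤-trans r≤n′ (m≤m+n n′ p′)) refl)
                | src-view {p′} {j} (before (+-cancelˡ-≤ i r j x≤i+j)) = refl
...   | _ | after z i<z refl = ⊥-elim (<⇒≱ (+-mono-<-≤ i<z j≤n′) x≤i+j)
src₃-seq n′ p′ i j x j≤n′ | _ | inside r (1≤r , r≤p′) refl
  rewrite +-assoc i j r
        | src-view {n′ + p′} {i} (inside (j + r) (≤-trans 1≤r (m≤n+m r j) , +-mono-≤ j≤n′ r≤p′) refl)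
        | src-view {p′} {j} (inside r (1≤r , r≤p′) refl) = refl
src₃-seq n′ p′ i j x j≤n′ | _ | after z i+j<z refl with src (suc n′) (suc i) z | srcView n′ i z
...   | _ | before z≤i = ⊥-elim (<⇒≱ i+j<z (≤-trans z≤i (m≤m+n i j)))
...   | _ | inside r (1≤r , r≤n′) refl
          rewrite +-assoc i r p′
                | src-view {n′ + p′} {i} (inside (r + p′) (≤-trans 1≤r (m≤m+n r p′) , +-monoˡ-≤ p′ r≤n′) refl)
                | src-view {p′} {j} (after r (+-cancelˡ-< i j r i+j<z) refl) = refl
...   | _ | after w i<w refl
          rewrite +-assoc w n′ p′
                | src-view {n′ + p′} {i} (after w i<w refl) = refl

src₃-par : ∀ n′ p′ i k x → i < k →
  src₃ˡ (suc n′) (suc i) (src (suc p′) (suc (k + n′)) x) ≡ swapGH (src₃ˡ (suc p′) (suc k) (src (suc n′) (suc i) x))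
src₃-par n′ p′ i k x i<k with src (suc p′) (suc (k + n′)) x | srcView p′ (k + n′) x
... | _ | before x≤k+n′ with src (suc n′) (suc i) x | srcView n′ i x
...   | _ | before x≤i
          rewrite src-view {p′} {k} (before (≤-trans x≤i (<⇒≤ i<k))) = refl
...   | _ | inside r _ refl = refl
...   | _ | after z _ refl
          rewrite src-view {p′} {k} (before (+-cancelʳ-≤ n′ z k x≤k+n′)) = refl
src₃-par n′ p′ i k x i<k | _ | inside r r∈ refl
  rewrite +-assoc k n′ r | +-comm n′ r | sym (+-assoc k r n′)
        | src-view {n′} {i} (after (k + r) (≤-trans i<k (m≤m+n k r)) refl)
        | src-view {p′} {k} (inside r r∈ refl) = refl
src₃-par n′ p′ i k x i<k | _ | after z k+n′<z refl with src (suc n′) (suc i) z | srcView n′ i z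
...   | _ | before z≤i = ⊥-elim (<⇒≱ k+n′<z (≤-trans z≤i (≤-trans (<⇒≤ i<k) (m≤m+n k n′))))
...   | _ | inside r (_ , r≤n′) refl = ⊥-elim (<⇒≱ k+n′<z (+-mono-≤ (<⇒≤ i<k) r≤n′))
...   | _ | after w i<w refl
          rewrite +-assoc w n′ p′ | +-comm n′ p′ | sym (+-assoc w p′ n′)
                | src-view {n′} {i} (after (w + p′) (≤-trans i<w (m≤m+n w p′)) refl)
                | src-view {p′} {k} (after w (+-cancelʳ-< n′ k w k+n′<z) refl) = refl

eval-resp : ∀ {a b} {s : Tm a} {t : Tm b} → s ~ t → eval s ≐⟨ a ∸ 1 ⟩ eval t
eval-resp ~refl _ _ _ _ = refl
eval-resp (~sym s~t) = ≐-sym (≐-cast (cong (_∸ 1) (~-arity s~t)) (eval-resp s~t))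
eval-resp (~trans s~t t~u) = ≐-trans (eval-resp s~t) (≐-cast (cong (_∸ 1) (sym (~-arity s~t))) (eval-resp t~u))
eval-resp (~cong {f = f} {g = g} i _ i≡i′ f~f′ g~g′) with ~-arity f~f′ | ~-arity g~g′ | arity-suc f | arity-suc g
... | refl | refl | m′ , refl | n′ , refl rewrite sym i≡i′ =
  ≐-cast (sym (+-suc-∸1 m′ n′)) (compR-cong (s≤s⁻¹ (toℕ<n i)) (eval-resp f~f′) (eval-resp g~g′))
eval-resp (unitˡ f) with arity-suc f
... | n′ , refl = compR-unitˡ n′ (eval f)
eval-resp (unitʳ f i) x y _ _ = compR-unitʳ (toℕ i) (eval f) x y
eval-resp (assocSeq f g h i j k k≡i+j) x y _ _ with arity-suc g | arity-suc h
... | n′ , refl | p′ , refl rewrite k≡i+j | +-suc n′ p′ =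
  trans (compR-compRˡ F G H (suc p′) (suc (toℕ i + toℕ j)) (suc n′) (suc (toℕ i)) x y)
    (trans (cong₂ (srcRel₃ F G H) (src₃-seq n′ p′ (toℕ i) (toℕ j) x j≤n′) (src₃-seq n′ p′ (toℕ i) (toℕ j) y j≤n′))
      (sym (compR-compRʳ F G H (suc (n′ + p′)) (suc (toℕ i)) (suc p′) (suc (toℕ j)) x y)))
  where
  F = eval f
  G = eval g
  H = eval h
  j≤n′ = s≤s⁻¹ (toℕ<n j)
eval-resp (assocPar f g h i k k′ i′ i<k k′≡k+n-1 i′≡i) x y _ _ with arity-suc g | arity-suc h
... | n′ , refl | p′ , refl rewrite k′≡k+n-1 | +-suc-∸1 (toℕ k) n′ | i′≡i =
  trans (compR-compRˡ F G H (suc p′) (suc (toℕ k + n′)) (suc n′) (suc (toℕ i)) x y)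
    (trans (cong₂ (srcRel₃ F G H) (src₃-par n′ p′ (toℕ i) (toℕ k) x i<k) (src₃-par n′ p′ (toℕ i) (toℕ k) y i<k))
      (sym (trans (compR-compRˡ F H G (suc n′) (suc (toℕ i)) (suc p′) (suc (toℕ k)) x y)
                  (srcRel₃-swapGH F G H (label x) (label y)))))
  where
  F = eval f
  G = eval g
  H = eval h
  label : ℕ → Src₃
  label z = src₃ˡ (suc p′) (suc (toℕ k)) (src (suc n′) (suc (toℕ i)) z)
eval-resp (qrel a b) =
  subst (λ w → compR (2 + b) (suc w) pR pR ≐⟨ suc a + (2 + b) ∸ 1 ⟩ compR (2 + a) 1 pR pR)
        (sym (toℕ-fromℕ (suc a)))
        (≐-cast (sym (+-suc-∸1 (suc a) (suc b))) (p-last≐p-first (suc a) (suc b)))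

-- Normal forms

data Comb : ℕ → Set where
  nil  : Comb 1
  snoc : ∀ {m} → Comb m → Fin m → (k : ℕ) → Comb (m + suc (suc k) ∸ 1)

toTm : ∀ {a} → Comb a → Tm a
toTm nil = idₜ
toTm (snoc c i k) = toTm c ∘⟨ i ⟩ q k

GapsBelow : ∀ {a} → Comb a → ℕ → Set
GapsBelow nil b = ⊤
GapsBelow (snoc c i k) b = GapsBelow c b × toℕ i < b

Increasing : ∀ {a} → Comb a → Set
Increasing nil = ⊤
Increasing (snoc c i k) = Increasing c × GapsBelow c (toℕ i)

gapsBelow-mono : ∀ {a} (c : Comb a) {b b′} → b ≤ b′ → GapsBelow c b → GapsBelow c b′
gapsBelow-mono nil _ _ = tt
gapsBelow-mono (snoc c i k) b≤b′ (c<b , i<b) = gapsBelow-mono c b≤b′ c<b , <-≤-trans i<b b≤b′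

gapsBelow-arity : ∀ {a} (c : Comb a) → GapsBelow c a
gapsBelow-arity nil = tt
gapsBelow-arity (snoc {m} c i k) = gapsBelow-mono c m≤a (gapsBelow-arity c) , <-≤-trans (toℕ<n i) m≤a
  where
  m≤a : m ≤ m + suc (suc k) ∸ 1
  m≤a = subst (m ≤_) (sym (+-suc-∸1 m (suc k))) (m≤m+n m (suc k))

NormalForm : ∀ {a} → Tm a → Set
NormalForm t = Σ ℕ λ a′ → Σ (Comb a′) λ w → Increasing w × t ~ toTm w

∘-cong : ∀ {m m′ n n′} {f : Tm m} {f′ : Tm m′} {g : Tm n} {g′ : Tm n′} →
         (f~f′ : f ~ f′) → g ~ g′ → (i : Fin m) → (f ∘⟨ i ⟩ g) ~ (f′ ∘⟨ Fin.cast (~-arity f~f′) i ⟩ g′)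
∘-cong f~f′ g~g′ i = ~cong i _ (sym (toℕ-cast (~-arity f~f′) i)) f~f′ g~g′

gap-after : ∀ {m} (i : Fin m) (k : ℕ) → Fin (m + suc (suc k) ∸ 1)
gap-after {m} i k = fromℕ< (subst (toℕ i + suc k <_) (sym (+-suc-∸1 m (suc k))) (+-monoˡ-< (suc k) (toℕ<n i)))

toℕ-gap-after : ∀ {m} (i : Fin m) k → toℕ (gap-after i k) ≡ toℕ i + suc k
toℕ-gap-after i k = toℕ-fromℕ< _

q-slide : ∀ {m} (f : Tm m) (k k′ : ℕ) (p : Fin (m + suc (suc k′) ∸ 1)) (i : Fin m) → toℕ p ≡ toℕ i →
          ((f ∘⟨ i ⟩ q k′) ∘⟨ p ⟩ q k) ~ ((f ∘⟨ i ⟩ q k) ∘⟨ gap-after i k ⟩ q k′)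
q-slide f k k′ p i p≡i =
  ~trans (assocSeq f (q k′) (q k) i Fin.zero p (trans p≡i (sym (+-identityʳ (toℕ i)))))
  (~trans (~cong i i refl ~refl (~sym (qrel k k′)))
  (~sym (assocSeq f (q k) (q k′) i (fromℕ (suc k)) (gap-after i k)
                  (trans (toℕ-gap-after i k) (cong (toℕ i +_) (sym (toℕ-fromℕ (suc k))))))))

q-pass : ∀ {m} (f : Tm m) (k k′ : ℕ) (p : Fin (m + suc (suc k′) ∸ 1)) (p₀ i : Fin m) →
         toℕ p ≡ toℕ p₀ → toℕ p₀ < toℕ i →
         ((f ∘⟨ i ⟩ q k′) ∘⟨ p ⟩ q k) ~ ((f ∘⟨ p₀ ⟩ q k) ∘⟨ gap-after i k ⟩ q k′)
q-pass f k k′ p p₀ i p≡p₀ p₀<i =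
  ~sym (assocPar f (q k) (q k′) p₀ i (gap-after i k) p p₀<i
                 (trans (toℕ-gap-after i k) (sym (+-suc-∸1 (toℕ i) (suc k)))) p≡p₀)

-- For p > i nothing is to be done, for p = i the relation qrel lets q_k slide under
-- q_k′, and for p < i parallel associativity lets it pass q_k′ before recursing.
insert-q : ∀ {m} (c : Comb m) → Increasing c → (p : Fin m) (k b : ℕ) → GapsBelow c b → toℕ p < b →
           Σ ℕ λ a → Σ (Comb a) λ w → Increasing w × GapsBelow w (b + suc k) × (toTm c ∘⟨ p ⟩ q k) ~ toTm w
insert-q nil _ Fin.zero k b _ p<b =
  _ , snoc nil Fin.zero k , (tt , tt) , (tt , ≤-trans p<b (m≤m+n b (suc k))) , ~refl
insert-q (snoc {m₀} c₀ i k′) (inc₀ , c₀<i) p k b (c₀<b , i<b) p<b with <-cmp (toℕ p) (toℕ i)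
... | tri> _ _ i<p =
  _ , snoc (snoc c₀ i k′) p k , ((inc₀ , c₀<i) , (gapsBelow-mono c₀ (<⇒≤ i<p) c₀<i , i<p)) ,
  ((gapsBelow-mono c₀ b≤b+k c₀<b , ≤-trans i<b b≤b+k) , ≤-trans p<b b≤b+k) , ~refl
  where
  b≤b+k = m≤m+n b (suc k)
... | tri≈ _ p≡i _ =
  _ , snoc (snoc c₀ i k) j k′ ,
  ((inc₀ , c₀<i) , (subst (GapsBelow c₀) (sym j≡) (gapsBelow-mono c₀ (m≤m+n (toℕ i) (suc k)) c₀<i) ,
                    subst (toℕ i <_) (sym j≡) (m<m+n (toℕ i) z<s))) ,
  ((gapsBelow-mono c₀ b≤b+k c₀<b , ≤-trans i<b b≤b+k) , subst (_< b + suc k) (sym j≡) (+-monoˡ-< (suc k) i<b)) ,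
  q-slide (toTm c₀) k k′ p i p≡i
  where
  b≤b+k = m≤m+n b (suc k)
  j = gap-after i k
  j≡ = toℕ-gap-after i k
... | tri< p<i _ _ =
  let (_ , w₀ , incw₀ , w₀<i+k , c₀p~w₀) = insert-q c₀ inc₀ p₀ k (toℕ i) c₀<i p₀<i
      j = Fin.cast (~-arity c₀p~w₀) (gap-after i k)
      j≡ = trans (toℕ-cast (~-arity c₀p~w₀) (gap-after i k)) (toℕ-gap-after i k)
  in _ , snoc w₀ j k′ , (incw₀ , subst (GapsBelow w₀) (sym j≡) w₀<i+k) ,
     (gapsBelow-mono w₀ (+-monoˡ-≤ (suc k) (<⇒≤ i<b)) w₀<i+k , subst (_< b + suc k) (sym j≡) (+-monoˡ-< (suc k) i<b)) ,
     ~trans (q-pass (toTm c₀) k k′ p p₀ i (sym (toℕ-fromℕ< p₀<)) p₀<i) (∘-cong c₀p~w₀ ~refl (gap-after i k))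
  where
  p₀< = <-trans p<i (toℕ<n i)
  p₀ = fromℕ< p₀<
  p₀<i : toℕ p₀ < toℕ i
  p₀<i = subst (_< toℕ i) (sym (toℕ-fromℕ< p₀<)) p<i

gap-sum : ∀ {m n} → Fin m → Fin n → Fin (m + n ∸ 1)
gap-sum {suc m} i j = fromℕ< (+-mono-≤-< (s≤s⁻¹ (toℕ<n i)) (toℕ<n j))

toℕ-gap-sum : ∀ {m n} (i : Fin m) (j : Fin n) → toℕ (gap-sum i j) ≡ toℕ i + toℕ j
toℕ-gap-sum {suc m} i j = toℕ-fromℕ< _

graft : ∀ {m n} (c : Comb m) (d : Comb n) → Increasing c → (i : Fin m) → NormalForm (toTm c ∘⟨ i ⟩ toTm d)
graft c nil inc i = _ , c , inc , unitʳ (toTm c) i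
graft c (snoc d₀ j k) inc i =
  let (a₀ , w₀ , inc₀ , cd₀~w₀) = graft c d₀ inc i
      l = Fin.cast (~-arity cd₀~w₀) (gap-sum i j)
      (a , w , incw , _ , w₀l~w) = insert-q w₀ inc₀ l k a₀ (gapsBelow-arity w₀) (toℕ<n l)
  in a , w , incw ,
     ~trans (~sym (assocSeq (toTm c) (toTm d₀) (q k) i j (gap-sum i j) (toℕ-gap-sum i j)))
            (~trans (∘-cong cd₀~w₀ ~refl (gap-sum i j)) w₀l~w)

normalise : ∀ {a} (t : Tm a) → NormalForm t
normalise idₜ = _ , nil , tt , ~refl
normalise (q k) = _ , snoc nil Fin.zero k , (tt , tt) , ~sym (unitˡ (q k))
normalise (f ∘⟨ i ⟩ g) =
  let (_ , w₁ , inc₁ , f~w₁) = normalise f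
      (_ , w₂ , _ , g~w₂) = normalise g
      (a , w , inc , w₁w₂~w) = graft w₁ w₂ inc₁ (Fin.cast (~-arity f~w₁) i)
  in a , w , inc , ~trans (∘-cong f~w₁ g~w₂ i) w₁w₂~w

BlockMin : BRel → ℕ → Set
BlockMin R y = ∀ z → 1 ≤ z → z < y → R z y ≡ false

blockMin-≐ : ∀ {K R S y} → R ≐⟨ K ⟩ S → y ≤ K → BlockMin S y → BlockMin R y
blockMin-≐ R≐S y≤K S-min z 1≤z z<y = trans (R≐S z _ (1≤z , ≤-trans (<⇒≤ z<y) y≤K) (≤-trans 1≤z (<⇒≤ z<y) , y≤K)) (S-min z 1≤z z<y)

blockMin-viewᴾ : ∀ {n i R Q y z} → SrcView n i y (fromP z) → BlockMin (compR (suc n) (suc i) R Q) y → BlockMin R z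
blockMin-viewᴾ {n} {i} {R} {Q} vy y-min w 1≤w w<z =
  trans (sym (compR-view R Q (χ-view n i w) vy))
        (y-min (χ n i w) (≤-trans 1≤w (χ-≥ n i w)) (viewᴾ-<-mono (χ-view n i w) vy w<z))

newBlock-min : ∀ R k i → BlockMin (compR (2 + k) (suc i) R pR) (suc i)
newBlock-min R k i z _ z<1+i = compR-view {i = i} R pR (before (s≤s⁻¹ z<1+i)) (inside 1 (≤-refl , s≤s z≤n) (+-comm 1 i))

newBlock-inside : ∀ R k i r → In (suc k) r → compR (2 + k) (suc i) R pR (suc i) (i + r) ≡ true
newBlock-inside R k i r r∈ = compR-view R pR (inside 1 (≤-refl , s≤s z≤n) (+-comm 1 i)) (inside r r∈ refl)

newBlock-outside : ∀ R k i y → i + suc k < y → compR (2 + k) (suc i) R pR (suc i) y ≡ false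
newBlock-outside R k i y i+k<y = outside (srcView (suc k) i y)
  where
  outside : ∀ {s} → SrcView (suc k) i y s → compR (2 + k) (suc i) R pR (suc i) y ≡ false
  outside (before y≤i) = ⊥-elim (<⇒≱ i+k<y (≤-trans y≤i (m≤m+n i (suc k))))
  outside (inside r (_ , r≤k) y≡) = ⊥-elim (<⇒≱ i+k<y (subst (_≤ i + suc k) (sym y≡) (+-monoʳ-≤ i r≤k)))
  outside vy@(after _ _ _) = compR-view R pR (inside 1 (≤-refl , s≤s z≤n) (+-comm 1 i)) vy

blockMin-or-below : ∀ R y → BlockMin R y ⊎ Σ ℕ λ z → 1 ≤ z × z < y × R z y ≡ true
blockMin-or-below R y with anyUpTo? (λ z → (1 ≤? z) ×-dec (R z y Bool.≟ true)) y
... | yes (z , z<y , 1≤z , Rzy) = inj₂ (z , 1≤z , z<y , Rzy)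
... | no ∄ = inj₁ λ z 1≤z z<y → ¬-not (λ Rzy → ∄ (z , z<y , 1≤z , Rzy))

blockMin? : ∀ R → Decidable (BlockMin R)
blockMin? R y with blockMin-or-below R y
... | inj₁ min = yes min
... | inj₂ (z , 1≤z , z<y , Rzy) = no λ min → false≢true (trans (sym (min z 1≤z z<y)) Rzy)

module _ {K R} (ncp : IsNCP K R) where
  open IsNCP ncp

  blockMin-of : ∀ y → In K y → Σ ℕ λ m → 1 ≤ m × m ≤ y × R m y ≡ true × BlockMin R m
  blockMin-of = <-rec _ go
    where
    go : ∀ y → (∀ {z} → z < y → In K z → Σ ℕ λ m → 1 ≤ m × m ≤ z × R m z ≡ true × BlockMin R m) →
         In K y → Σ ℕ λ m → 1 ≤ m × m ≤ y × R m y ≡ true × BlockMin R m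
    go y rec y∈@(1≤y , y≤K) with blockMin-or-below R y
    ... | inj₁ min = y , 1≤y , ≤-refl , reflexive y y∈ , min
    ... | inj₂ (z , 1≤z , z<y , Rzy) =
      let z∈ = 1≤z , ≤-trans (<⇒≤ z<y) y≤K
          (m , 1≤m , m≤z , Rmz , min) = rec z<y z∈
      in m , 1≤m , ≤-trans m≤z (<⇒≤ z<y) , transitive m z y (1≤m , ≤-trans m≤z (proj₂ z∈)) z∈ y∈ Rmz Rzy , min

-- Faithfulness

increasing-blockMin≤ : ∀ {a} (c : Comb a) → Increasing c → ∀ {b} → GapsBelow c b →
                       ∀ y → y ≤ a ∸ 1 → BlockMin (eval (toTm c)) y → y ≤ b
increasing-blockMin≤ nil _ _ y y≤0 _ = ≤-trans y≤0 z≤n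
increasing-blockMin≤ (snoc c₀ i k) (inc₀ , c₀<i) {b} (_ , i<b) y y≤a y-min with arity-suc (toTm c₀)
... | m₀′ , refl with y ≤? b
...   | yes y≤b = y≤b
...   | no  y≰b = ⊥-elim (beyond (srcView (suc k) (toℕ i) y))
  where
  beyond : ∀ {s} → SrcView (suc k) (toℕ i) y s → ⊥
  beyond (before y≤i) = y≰b (≤-trans y≤i (<⇒≤ i<b))
  beyond vy@(inside _ _ _) =
    false≢true (trans (sym (y-min (suc (toℕ i)) (s≤s z≤n) (≤-<-trans i<b (≰⇒> y≰b))))
                      (compR-view (eval (toTm c₀)) pR (inside 1 (≤-refl , s≤s z≤n) (+-comm 1 (toℕ i))) vy))
  beyond vy@(after z i<z refl) =
    <⇒≱ i<z (increasing-blockMin≤ c₀ inc₀ c₀<i z z≤m₀′ (blockMin-viewᴾ vy y-min))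
    where
    z≤m₀′ : z ≤ m₀′
    z≤m₀′ = +-cancelʳ-≤ (suc k) z m₀′ (subst (z + suc k ≤_) (+-suc-∸1 m₀′ (suc k)) y≤a)

gap<arity : ∀ {m′} (i : Fin (suc m′)) l → suc (toℕ i) ≤ m′ + suc l
gap<arity {m′} i l = subst (suc (toℕ i) ≤_) (sym (+-suc m′ l)) (s≤s (≤-trans (s≤s⁻¹ (toℕ<n i)) (m≤m+n m′ l)))

last-gap-≮ : ∀ {m₀′ k R l} (c₀ : Comb (suc m₀′)) (i : Fin (suc m₀′)) → Increasing (snoc c₀ i k) →
             ∀ j → toℕ i < j → suc j ≤ m₀′ + suc k →
             eval (toTm (snoc c₀ i k)) ≐⟨ m₀′ + suc k ⟩ compR (2 + l) (suc j) R pR → ⊥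
last-gap-≮ {m₀′} {k} {R} {l} c₀ i (inc₀ , c₀<i) j i<j j<K E =
  <⇒≱ (s≤s i<j) (increasing-blockMin≤ (snoc c₀ i k) (inc₀ , c₀<i) {suc (toℕ i)}
                   (gapsBelow-mono c₀ (n≤1+n (toℕ i)) c₀<i , ≤-refl) (suc j)
                   (subst (suc j ≤_) (sym (+-suc-∸1 m₀′ (suc k))) j<K)
                   (blockMin-≐ E j<K (newBlock-min R l j)))

last-block-≮ : ∀ {K R₀ R₁ i k l} → i + suc l ≤ K →
               compR (2 + k) (suc i) R₀ pR ≐⟨ K ⟩ compR (2 + l) (suc i) R₁ pR → k < l → ⊥
last-block-≮ {K} {R₀} {R₁} {i} {k} {l} i+l≤K E k<l =
  false≢true (trans (sym (newBlock-outside R₀ k i (i + suc l) (+-monoʳ-< i (s≤s k<l))))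
               (trans (E (suc i) (i + suc l) (s≤s z≤n , ≤-trans 1+i≤i+l i+l≤K) (≤-trans (s≤s z≤n) 1+i≤i+l , i+l≤K))
                 (newBlock-inside R₁ l i (suc l) (s≤s z≤n , ≤-refl))))
  where
  1+i≤i+l : suc i ≤ i + suc l
  1+i≤i+l = subst (suc i ≤_) (sym (+-suc i l)) (s≤s (m≤m+n i l))

-- The last gap is where the largest block minimum sits, and the last generator is the
-- size of its block; both are therefore determined by the value.
module SameLastInsertion {m₀′ m₁′ k l} (c₀ : Comb (suc m₀′)) (c₁ : Comb (suc m₁′))
  (i : Fin (suc m₀′)) (j : Fin (suc m₁′)) (inc₀ : Increasing (snoc c₀ i k)) (inc₁ : Increasing (snoc c₁ j l))
  (K≡ : m₀′ + suc k ≡ m₁′ + suc l)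
  (E : eval (toTm (snoc c₀ i k)) ≐⟨ m₀′ + suc k ⟩ eval (toTm (snoc c₁ j l))) where

  gap≡ : toℕ i ≡ toℕ j
  gap≡ with <-cmp (toℕ i) (toℕ j)
  ... | tri< i<j _ _ = ⊥-elim (last-gap-≮ c₀ i inc₀ (toℕ j) i<j (subst (suc (toℕ j) ≤_) (sym K≡) (gap<arity j l)) E)
  ... | tri≈ _ i≡j _ = i≡j
  ... | tri> _ _ j<i = ⊥-elim (last-gap-≮ c₁ j inc₁ (toℕ i) j<i (subst (suc (toℕ i) ≤_) K≡ (gap<arity i k)) (≐-cast K≡ (≐-sym E)))

  E′ : compR (2 + k) (suc (toℕ i)) (eval (toTm c₀)) pR ≐⟨ m₀′ + suc k ⟩ compR (2 + l) (suc (toℕ i)) (eval (toTm c₁)) pR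
  E′ = subst (λ g → _ ≐⟨ _ ⟩ compR (2 + l) (suc g) (eval (toTm c₁)) pR) (sym gap≡) E

  size≡ : k ≡ l
  size≡ with <-cmp k l
  ... | tri< k<l _ _ = ⊥-elim (last-block-≮ i+l≤K E′ k<l)
    where
    i+l≤K : toℕ i + suc l ≤ m₀′ + suc k
    i+l≤K = subst (toℕ i + suc l ≤_) (sym K≡) (+-monoˡ-≤ (suc l) (subst (_≤ m₁′) (sym gap≡) (s≤s⁻¹ (toℕ<n j))))
  ... | tri≈ _ k≡l _ = k≡l
  ... | tri> _ _ l<k = ⊥-elim (last-block-≮ i+k≤K (≐-cast K≡ (≐-sym E′)) l<k)
    where
    i+k≤K : toℕ i + suc k ≤ m₁′ + suc l
    i+k≤K = subst (toℕ i + suc k ≤_) K≡ (+-monoˡ-≤ (suc k) (s≤s⁻¹ (toℕ<n i)))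

  rest≡ : m₀′ ≡ m₁′
  rest≡ = +-cancelʳ-≡ (suc k) m₀′ m₁′ (subst (λ l′ → m₀′ + suc k ≡ m₁′ + suc l′) (sym size≡) K≡)

snoc-arity≢1 : ∀ m′ l → m′ + suc (suc l) ≢ 1
snoc-arity≢1 m′ l e with subst (2 ≤_) e (≤-trans (s≤s (s≤s z≤n)) (m≤n+m (suc (suc l)) m′))
... | s≤s ()

snoc-arity-cancel : ∀ m₀′ m₁′ k l → m₀′ + suc (suc k) ≡ m₁′ + suc (suc l) → m₀′ + suc k ≡ m₁′ + suc l
snoc-arity-cancel m₀′ m₁′ k l e = suc-injective (trans (sym (+-suc m₀′ (suc k))) (trans e (+-suc m₁′ (suc l))))

comb-injective : ∀ {a a′} (c : Comb a) (c′ : Comb a′) → a ≡ a′ → Increasing c → Increasing c′ →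
                 eval (toTm c) ≐⟨ a ∸ 1 ⟩ eval (toTm c′) → toTm c ~ toTm c′
comb-injective nil nil _ _ _ _ = ~refl
comb-injective nil (snoc c₁ _ l) 1≡a′ _ _ _ with arity-suc (toTm c₁)
... | m₁′ , refl = ⊥-elim (snoc-arity≢1 m₁′ l (sym 1≡a′))
comb-injective (snoc c₀ _ k) nil a≡1 _ _ _ with arity-suc (toTm c₀)
... | m₀′ , refl = ⊥-elim (snoc-arity≢1 m₀′ k a≡1)
comb-injective (snoc c₀ i k) (snoc c₁ j l) a≡a′ inc₀ inc₁ E with arity-suc (toTm c₀) | arity-suc (toTm c₁)
... | m₀′ , refl | m₁′ , refl with last.size≡ | last.rest≡
  where
  module last = SameLastInsertion c₀ c₁ i j inc₀ inc₁ (snoc-arity-cancel m₀′ m₁′ k l a≡a′) (≐-cast (+-suc-∸1 m₀′ (suc k)) E)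
... | refl | refl =
  ~cong i j last.gap≡ (comb-injective c₀ c₁ refl (proj₁ inc₀) (proj₁ inc₁) (compR-cancelˡ (s≤s⁻¹ (toℕ<n i)) last.E′)) ~refl
  where
  module last = SameLastInsertion c₀ c₁ i j inc₀ inc₁ (snoc-arity-cancel m₀′ m₀′ k k a≡a′) (≐-cast (+-suc-∸1 m₀′ (suc k)) E)

eval-faithful : ∀ {a} (s t : Tm a) → eval s ≐⟨ a ∸ 1 ⟩ eval t → s ~ t
eval-faithful s t E =
  let (a₁ , w₁ , inc₁ , s~w₁) = normalise s
      (a₂ , w₂ , inc₂ , t~w₂) = normalise t
      E′ : eval (toTm w₁) ≐⟨ a₁ ∸ 1 ⟩ eval (toTm w₂)
      E′ = ≐-cast (cong (_∸ 1) (~-arity s~w₁)) (≐-trans (≐-sym (eval-resp s~w₁)) (≐-trans E (eval-resp t~w₂)))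
  in ~trans s~w₁ (~trans (comb-injective w₁ w₂ (trans (sym (~-arity s~w₁)) (~-arity t~w₂)) inc₁ inc₂ E′) (~sym t~w₂))

-- Surjectivity

greatest : ∀ {P : ℕ → Set} → Decidable P → ∀ lo hi → P lo → lo ≤ hi →
           Σ ℕ λ e → lo ≤ e × e ≤ hi × P e × (∀ y → e < y → y ≤ hi → ¬ P y)
greatest {P} P? lo hi Plo lo≤hi with P? hi
... | yes Phi = hi , lo≤hi , ≤-refl , Phi , λ y hi<y y≤hi _ → <⇒≱ hi<y y≤hi
greatest P? lo zero Plo z≤n | no ¬P0 = ⊥-elim (¬P0 Plo)
greatest {P} P? lo (suc h) Plo lo≤1+h | no ¬P1+h with m≤n⇒m<n∨m≡n lo≤1+h
... | inj₂ refl = ⊥-elim (¬P1+h Plo)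
... | inj₁ lo<1+h =
  let (e , lo≤e , e≤h , Pe , none-above) = greatest P? lo h Plo (s≤s⁻¹ lo<1+h)
  in e , lo≤e , m≤n⇒m≤1+n e≤h , Pe , none-above′ none-above
  where
  none-above′ : ∀ {e} → (∀ y → e < y → y ≤ h → ¬ P y) → ∀ y → e < y → y ≤ suc h → ¬ P y
  none-above′ none-above y e<y y≤1+h with m≤n⇒m<n∨m≡n y≤1+h
  ... | inj₁ y<1+h = none-above y e<y (s≤s⁻¹ y<1+h)
  ... | inj₂ refl  = ¬P1+h

eval-subst : ∀ {a b} (a≡b : a ≡ b) (t : Tm a) → eval (subst Tm a≡b t) ≡ eval t
eval-subst refl t = refl

record LastBlock (K : ℕ) (R : BRel) : Set where
  field
    i k          : ℕ
    end≤K        : i + suc k ≤ K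
    start-min    : BlockMin R (suc i)
    no-later-min : ∀ y → suc i < y → y ≤ K → ¬ BlockMin R y
    start~end    : R (suc i) (i + suc k) ≡ true
    end-max      : ∀ y → i + suc k < y → y ≤ K → R (suc i) y ≢ true

lastBlock : ∀ K R → IsNCP (suc K) R → LastBlock (suc K) R
lastBlock K R ncp =
  let (b , 1≤b , b≤K , b-min , no-later-min) =
        greatest (blockMin? R) 1 (suc K) (λ _ 1≤z z<1 → ⊥-elim (<⇒≱ 1≤z (s≤s⁻¹ z<1))) (s≤s z≤n)
  in last-of b 1≤b b≤K b-min no-later-min
  where
  last-of : ∀ b → 1 ≤ b → b ≤ suc K → BlockMin R b → (∀ y → b < y → y ≤ suc K → ¬ BlockMin R y) → LastBlock (suc K) R
  last-of (suc i) _ b≤K b-min no-later-min =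
    let (e , b≤e , e≤K , Rbe , end-max) =
          greatest (λ y → R (suc i) y Bool.≟ true) (suc i) (suc K) (IsNCP.reflexive ncp (suc i) (s≤s z≤n , b≤K)) b≤K
        e≡ : i + suc (e ∸ suc i) ≡ e
        e≡ = trans (+-suc i (e ∸ suc i)) (m+[n∸m]≡n b≤e)
    in record
         { i = i ; k = e ∸ suc i
         ; end≤K = subst (_≤ suc K) (sym e≡) e≤K
         ; start-min = b-min
         ; no-later-min = no-later-min
         ; start~end = subst (λ y → R (suc i) y ≡ true) (sym e≡) Rbe
         ; end-max = λ y e<y y≤K → end-max y (subst (_< y) e≡ e<y) y≤K
         }

module RemoveLastBlock {K R} (ncp : IsNCP K R) (lb : LastBlock K R) where
  open IsNCP ncp
  open LastBlock lb

  1+i≤end : suc i ≤ i + suc k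
  1+i≤end = subst (suc i ≤_) (sym (+-suc i k)) (s≤s (m≤m+n i k))

  in-block⇒In : ∀ {y} → suc i ≤ y → y ≤ i + suc k → In K y
  in-block⇒In 1+i≤y y≤end = ≤-trans (s≤s z≤n) 1+i≤y , ≤-trans y≤end end≤K

  -- The block of the last block minimum is an interval: a gap in it would be covered
  -- by a block with an earlier minimum, which would have to cross it.
  block-interval : ∀ y → suc i ≤ y → y ≤ i + suc k → R (suc i) y ≡ true
  block-interval y 1+i≤y y≤end with R (suc i) y in Rby
  ... | true = refl
  ... | false =
    let (m , 1≤m , m≤y , Rmy , m-min) = blockMin-of ncp y y∈
        m∈ = 1≤m , ≤-trans m≤y (proj₂ y∈)
        m<1+i = below-start m∈ Rmy m-min
    in ⊥-elim (false≢true (trans (sym (start-min m 1≤m m<1+i)) (joins-start m∈ m<1+i Rmy)))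
    where
    y∈ = in-block⇒In 1+i≤y y≤end
    below-start : ∀ {m} → In K m → R m y ≡ true → BlockMin R m → m < suc i
    below-start {m} m∈ Rmy m-min with <-cmp m (suc i)
    ... | tri< m<1+i _ _ = m<1+i
    ... | tri≈ _ refl _ = ⊥-elim (false≢true (trans (sym Rby) Rmy))
    ... | tri> _ _ 1+i<m = ⊥-elim (no-later-min m 1+i<m (proj₂ m∈) m-min)
    joins-start : ∀ {m} → In K m → m < suc i → R m y ≡ true → R m (suc i) ≡ true
    joins-start m∈ m<1+i Rmy with m≤n⇒m<n∨m≡n 1+i≤y | m≤n⇒m<n∨m≡n y≤end
    ... | inj₂ refl | _ = Rmy
    ... | inj₁ _ | inj₂ refl = ⊥-elim (false≢true (trans (sym Rby) start~end))
    ... | inj₁ 1+i<y | inj₁ y<end =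
      noncrossing _ y (suc i) (i + suc k) m∈ y∈ (in-block⇒In ≤-refl 1+i≤end) (in-block⇒In 1+i≤end ≤-refl)
                  m<1+i 1+i<y y<end Rmy start~end

  inside⇒in-block : ∀ {y r} → SrcView (suc k) i y (fromQ r) → suc i ≤ y × y ≤ i + suc k
  inside⇒in-block (inside r (1≤r , r≤1+k) refl) = subst (_≤ i + r) (+-comm i 1) (+-monoʳ-≤ i 1≤r) , +-monoʳ-≤ i r≤1+k

  viewᴾ⇒off-block : ∀ {x z} → SrcView (suc k) i x (fromP z) → x ≤ i ⊎ i + suc k < x
  viewᴾ⇒off-block (before x≤i) = inj₁ x≤i
  viewᴾ⇒off-block (after z i<z refl) = inj₂ (+-monoˡ-< (suc k) i<z)

  block-separated : ∀ {x y z r} → In K x → In K y → SrcView (suc k) i x (fromP z) → SrcView (suc k) i y (fromQ r) →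
                    R x y ≡ false
  block-separated {x} {y} x∈ y∈ vx vy = ¬-not λ Rxy → off-block (viewᴾ⇒off-block vx) (joins-start Rxy)
    where
    b∈ = in-block⇒In ≤-refl 1+i≤end
    joins-start : R x y ≡ true → R x (suc i) ≡ true
    joins-start Rxy =
      let (1+i≤y , y≤end) = inside⇒in-block vy
      in transitive x y (suc i) x∈ y∈ b∈ Rxy (symmetric (suc i) y b∈ y∈ (block-interval y 1+i≤y y≤end))
    off-block : x ≤ i ⊎ i + suc k < x → R x (suc i) ≢ true
    off-block (inj₁ x≤i) Rx1+i = false≢true (trans (sym (start-min x (proj₁ x∈) (s≤s x≤i))) Rx1+i)
    off-block (inj₂ end<x) Rx1+i = end-max x end<x (proj₂ x∈) (symmetric x (suc i) x∈ b∈ Rx1+i)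

  K₀ : ℕ
  K₀ = K ∸ suc k

  K₀+1+k≡K : K₀ + suc k ≡ K
  K₀+1+k≡K = m∸n+n≡m (≤-trans (m≤n+m (suc k) i) end≤K)

  i≤K₀ : i ≤ K₀
  i≤K₀ = +-cancelʳ-≤ (suc k) i K₀ (subst (i + suc k ≤_) (sym K₀+1+k≡K) end≤K)

  In-K : ∀ {x} → In K x → In (K₀ + suc k) x
  In-K = subst (λ n → In n _) (sym K₀+1+k≡K)

  R₀ : BRel
  R₀ x y = R (χ (suc k) i x) (χ (suc k) i y)

  χ-In : ∀ {z} → In K₀ z → In K (χ (suc k) i z)
  χ-In z∈ = subst (λ n → In n _) K₀+1+k≡K (χ-in i≤K₀ z∈)

  R₀-isNCP : IsNCP K₀ R₀
  R₀-isNCP = record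
    { reflexive   = λ x x∈ → reflexive _ (χ-In x∈)
    ; symmetric   = λ x y x∈ y∈ → symmetric _ _ (χ-In x∈) (χ-In y∈)
    ; transitive  = λ x y z x∈ y∈ z∈ → transitive _ _ _ (χ-In x∈) (χ-In y∈) (χ-In z∈)
    ; noncrossing = λ a b c d a∈ b∈ c∈ d∈ a<c c<b b<d →
        noncrossing _ _ _ _ (χ-In a∈) (χ-In b∈) (χ-In c∈) (χ-In d∈) (χ-< a<c) (χ-< c<b) (χ-< b<d)
    }
    where
    χ-< : ∀ {a b} → a < b → χ (suc k) i a < χ (suc k) i b
    χ-< {a} {b} = viewᴾ-<-mono (χ-view (suc k) i a) (χ-view (suc k) i b)

  recompose : ∀ {P₀} → P₀ ≐⟨ K₀ ⟩ R₀ → compR (2 + k) (suc i) P₀ pR ≐⟨ K ⟩ R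
  recompose {P₀} P₀≐R₀ x y x∈ y∈ =
    trans (compR-view P₀ pR (srcView (suc k) i x) (srcView (suc k) i y)) (by-src (srcView (suc k) i x) (srcView (suc k) i y))
    where
    by-src : ∀ {s t} → SrcView (suc k) i x s → SrcView (suc k) i y t → srcRel P₀ pR s t ≡ R x y
    by-src {fromP a} {fromP b} vx vy =
      trans (P₀≐R₀ a b (view-in i≤K₀ (In-K x∈) vx) (view-in i≤K₀ (In-K y∈) vy))
            (sym (cong₂ R (viewᴾ⇒χ vx) (viewᴾ⇒χ vy)))
    by-src {fromQ _} {fromQ _} vx vy =
      let (1+i≤x , x≤end) = inside⇒in-block vx
          (1+i≤y , y≤end) = inside⇒in-block vy
          b∈ = in-block⇒In ≤-refl 1+i≤end
      in sym (transitive x (suc i) y x∈ b∈ y∈ (symmetric (suc i) x b∈ x∈ (block-interval x 1+i≤x x≤end))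
                                                (block-interval y 1+i≤y y≤end))
    by-src {fromP _} {fromQ _} vx vy = sym (block-separated x∈ y∈ vx vy)
    by-src {fromQ _} {fromP _} vx vy =
      sym (¬-not λ Rxy → false≢true (trans (sym (block-separated y∈ x∈ vy vx)) (symmetric x y x∈ y∈ Rxy)))

  K₀<K : K₀ < K
  K₀<K = subst (K₀ <_) K₀+1+k≡K (m<m+n K₀ z<s)

  extend : (t₀ : Tm (suc K₀)) → eval t₀ ≐⟨ K₀ ⟩ R₀ → Σ (Tm (suc K)) λ t → eval t ≐⟨ K ⟩ R
  extend t₀ t₀≐R₀ = subst Tm arity≡ t , λ x y x∈ y∈ → trans (cong (λ S → S x y) (eval-subst arity≡ t)) (eval-t≐R x y x∈ y∈)
    where
    i′ = fromℕ< (s≤s i≤K₀)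
    t = t₀ ∘⟨ i′ ⟩ q k
    arity≡ : K₀ + suc (suc k) ≡ suc K
    arity≡ = trans (+-suc K₀ (suc k)) (cong suc K₀+1+k≡K)
    eval-t≐R : eval t ≐⟨ K ⟩ R
    eval-t≐R = subst (λ g → compR (2 + k) (suc g) (eval t₀) pR ≐⟨ K ⟩ R) (sym (toℕ-fromℕ< (s≤s i≤K₀))) (recompose t₀≐R₀)

eval-surjective : ∀ K R → IsNCP K R → Σ (Tm (suc K)) λ t → eval t ≐⟨ K ⟩ R
eval-surjective = <-rec _ surj
  where
  surj : ∀ K → (∀ {K₀} → K₀ < K → ∀ R → IsNCP K₀ R → Σ (Tm (suc K₀)) λ t → eval t ≐⟨ K₀ ⟩ R) →
         ∀ R → IsNCP K R → Σ (Tm (suc K)) λ t → eval t ≐⟨ K ⟩ R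
  surj zero _ R _ = idₜ , λ x _ (1≤x , x≤0) _ → ⊥-elim (<⇒≱ 1≤x x≤0)
  surj (suc K′) rec R ncp =
    let open RemoveLastBlock ncp (lastBlock K′ R ncp)
        (t₀ , t₀≐R₀) = rec K₀<K R₀ R₀-isNCP
    in extend t₀ t₀≐R₀

mainTheorem6 : (∀ m n → 2 ≤ m → 2 ≤ n → compR n m pR pR ≐⟨ m + n ∸ 2 ⟩ compR m 1 pR pR)
    × (∀ {a} (t : Tm a) → IsNCP (a ∸ 1) (eval t))
    × (∀ {a} (s t : Tm a) → s ~ t → eval s ≐⟨ a ∸ 1 ⟩ eval t)
    × (∀ {a} (s t : Tm a) → eval s ≐⟨ a ∸ 1 ⟩ eval t → s ~ t)
    × (∀ a → 1 ≤ a → (R : BRel) → IsNCP (a ∸ 1) R → Σ (Tm a) (λ t → eval t ≐⟨ a ∸ 1 ⟩ R))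
mainTheorem6 = p-relation , eval-isNCP , (λ _ _ → eval-resp) , eval-faithful , surjective
  where
  p-relation : ∀ m n → 2 ≤ m → 2 ≤ n → compR n m pR pR ≐⟨ m + n ∸ 2 ⟩ compR m 1 pR pR
  p-relation (suc m′) (suc n′) _ _ = ≐-cast (sym (+-suc-∸1 m′ n′)) (p-last≐p-first m′ n′)
  surjective : ∀ a → 1 ≤ a → (R : BRel) → IsNCP (a ∸ 1) R → Σ (Tm a) (λ t → eval t ≐⟨ a ∸ 1 ⟩ R)
  surjective (suc K) _ = eval-surjective K
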